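{- Let $T$ be a tournament on $n$ vertices, let $v\in V(T)$, and let $c\in\mathbb{N}$ satisfy $2\le c\le \log d^-(v)-1$. Then there exist disjoint sets $A,E\subseteq V(T)$ such that: (i) $2\le|A|\le c$ and $T[A]$ is a transitive tournament with head $v$; (ii) $A$ out-dominates $V(T)\setminus(A\cup E)$; (iii) $|E|\le (1/2)^{c-1}d^-(v)$.
   Context: $\log$ is the binary logarithm; $d^-(v)$ is the in-degree of $v$ in $T$. A tournament is transitive if its vertices can be ordered $v_1,\dots,v_m$ with $v_iv_j$ an edge iff $i<j$; $v_m$ is its head. $A$ out-dominates $Z$ if every vertex of $Z$ is an out-neighbour of some vertex of $A$. -}

module Defs where

open import Data.Nat using (ℕ; suc)
open import Data.Bool using (Bool; true; false)
open import Data.Fin using (Fin; fromℕ; _<_)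
open import Data.Fin.Subset using (Subset; _∈_; _∉_; ∣_∣)
open import Data.Vec using (tabulate)
open import Data.Product using (Σ; ∃; _×_)
open import Data.Sum using (_⊎_)
open import Function.Definitions using (Injective)
open import Function.Bundles using (_⇔_)
open import Relation.Binary.PropositionalEquality using (_≡_; _≢_)

-- A tournament on vertex set Fin n: adj u v ≡ true means the edge u → v.
record Tournament (n : ℕ) : Set where
  field
    adj    : Fin n → Fin n → Bool
    irrefl : ∀ u → adj u u ≡ false
    tourn  : ∀ u v → u ≢ v →
             (adj u v ≡ true × adj v u ≡ false) ⊎ (adj u v ≡ false × adj v u ≡ true)
open Tournament public

inNbrs : ∀ {n} → Tournament n → Fin n → Subset n
inNbrs T v = tabulate (λ u → adj T u v)

indeg : ∀ {n} → Tournament n → Fin n → ℕ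
indeg T v = ∣ inNbrs T v ∣

TransitiveWithHead : ∀ {n} → Tournament n → Subset n → Fin n → Set
TransitiveWithHead {n} T A v =
  Σ ℕ λ k → Σ (Fin (suc k) → Fin n) λ f →
    Injective _≡_ _≡_ f
    × (∀ x → (x ∈ A) ⇔ (∃ λ i → f i ≡ x))
    × (∀ i j → (adj T (f i) (f j) ≡ true) ⇔ (i < j))
    × (f (fromℕ k) ≡ v)

OutDominates : ∀ {n} → Tournament n → Subset n → Subset n → Set
OutDominates T A Z = ∀ z → z ∈ Z → ∃ λ a → a ∈ A × adj T a z ≡ true

Disjoint : ∀ {n} → Subset n → Subset n → Set
Disjoint A E = ∀ x → x ∈ A → x ∉ E

-- Start from A = {v} and E = N⁻(v), and keep the invariant that every vertex
-- of E beats every vertex of A while every vertex outside A ∪ E is beaten by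
-- some vertex of A.  Inside E the in-degrees average (|E| − 1)/2, so some
-- u ∈ E has at most |E|/2 in-neighbours in E.  Putting u in front of A (it
-- beats all of A, so A stays transitive with head v) and shrinking E to its
-- in-neighbours in E preserves the invariant, since u beats the vertices
-- dropped from E, and halves |E|.  After c − 1 such steps, or as soon as E
-- is empty, A and E are as required; the first step is possible because
-- log d⁻(v) ≥ c + 1 forces d⁻(v) > 0.
module Submission where

open import Defs
open import Data.Bool using (Bool; true; false; _∧_)
open import Data.Bool.Properties using (¬-not)
open import Data.Fin as Fin using (Fin; zero; suc; fromℕ)
open import Data.Fin.Properties using (any?) renaming (_≟_ to _≟ᶠ_; <-cmp to <ᶠ-cmp)
open import Data.Fin.Subset using (Subset; _∈_; _∉_; ∣_∣; ∁; _∪_; _∩_; ⁅_⁆)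
open import Data.Fin.Subset.Properties
  using (_∈?_; x∈⁅x⁆; x∈⁅y⁆⇒x≡y; ∣⁅x⁆∣≡1; ∪-identityˡ; x∈p∪q⁺; x∈p∪q⁻;
         x∈p∩q⁺; x∈p∩q⁻; x∈∁p⇒x∉p; x∉p⇒x∈∁p)
open import Data.Nat
  using (ℕ; zero; suc; _+_; _*_; _^_; _∸_; _≤_; _<_; z≤n; s≤s; z<s; s<s; s<s⁻¹; _≤?_; _≟_)
open import Data.Nat.Logarithm using (⌊log₂_⌋)
open import Data.Nat.Properties
  using (+-*-semiring; module ≤-Reasoning; ≤-refl; ≤-reflexive; ≤-trans; <⇒≱; ≰⇒>;
         n≤1+n; m≤m+n; n≢0⇒n>0; +-identityʳ; +-suc; +-mono-≤; +-cancelʳ-≤;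
         *-identityˡ; *-identityʳ; *-suc; *-monoˡ-≤; *-monoʳ-≤)
open import Data.Nat.Tactic.RingSolver using (solve-∀)
open import Algebra.Properties.Semiring.Sum +-*-semiring
  using (sum-syntax; sum-cong-≗; ∑-distrib-+; ∑-comm; *-distribˡ-sum; *-distribʳ-sum)
open import Data.Product using (Σ; ∃; _×_; _,_; proj₁; proj₂)
open import Data.Empty using (⊥-elim)
open import Data.Sum using (inj₁; inj₂; [_,_])
open import Data.Vec using (_∷_; []; lookup; tabulate; here; there)
open import Data.Vec.Properties using (lookup∘tabulate; lookup-zipWith; []=⇒lookup; lookup⇒[]=)
import Data.Vec.Functional as Vector
open import Function using (_∘_; _⇔_; mk⇔; Equivalence)
open Equivalence using (to; from)
open import Function.Definitions using (Injective)
open import Relation.Binary using (tri<; tri≈; tri>)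
open import Relation.Binary.PropositionalEquality
  using (_≡_; _≢_; refl; sym; trans; cong; cong₂; subst; module ≡-Reasoning)
open import Relation.Nullary using (yes; no; contradiction)
open import Relation.Nullary.Decidable using (_×-dec_)

𝟙 : Bool → ℕ
𝟙 true  = 1
𝟙 false = 0

𝟙-∧ : ∀ a b → 𝟙 (a ∧ b) ≡ 𝟙 a * 𝟙 b
𝟙-∧ true  b = sym (+-identityʳ (𝟙 b))
𝟙-∧ false b = refl

𝟙≤1 : ∀ a → 𝟙 a ≤ 1
𝟙≤1 true  = ≤-refl
𝟙≤1 false = z≤n

∑-mono-≤ : ∀ {n} {f g : Fin n → ℕ} → (∀ i → f i ≤ g i) → ∑[ i < n ] f i ≤ ∑[ i < n ] g i
∑-mono-≤ {zero}  f≤g = z≤n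
∑-mono-≤ {suc n} f≤g = +-mono-≤ (f≤g zero) (∑-mono-≤ (f≤g ∘ suc))

∣p∣≡∑𝟙 : ∀ {n} (p : Subset n) → ∣ p ∣ ≡ ∑[ x < n ] 𝟙 (lookup p x)
∣p∣≡∑𝟙 []            = refl
∣p∣≡∑𝟙 (true  ∷ p) = cong suc (∣p∣≡∑𝟙 p)
∣p∣≡∑𝟙 (false ∷ p) = ∣p∣≡∑𝟙 p

x∈tabulate⇔ : ∀ {n} {f : Fin n → Bool} {x} → x ∈ tabulate f ⇔ f x ≡ true
x∈tabulate⇔ {f = f} {x} = mk⇔
  (λ x∈ → trans (sym (lookup∘tabulate f x)) ([]=⇒lookup x∈))
  (λ fx → lookup⇒[]= x (tabulate f) (trans (lookup∘tabulate f x) fx))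

x∈∁[p∪q]⇔ : ∀ {n} {x : Fin n} {p q : Subset n} → x ∈ ∁ (p ∪ q) ⇔ (x ∉ p × x ∉ q)
x∈∁[p∪q]⇔ {p = p} {q} = mk⇔
  (λ x∈ → x∈∁p⇒x∉p x∈ ∘ x∈p∪q⁺ ∘ inj₁ , x∈∁p⇒x∉p x∈ ∘ x∈p∪q⁺ ∘ inj₂)
  (λ (x∉p , x∉q) → x∉p⇒x∈∁p ([ x∉p , x∉q ] ∘ x∈p∪q⁻ p q))

x∉p⇒∣⁅x⁆∪p∣≡1+∣p∣ : ∀ {n} {x : Fin n} {p : Subset n} → x ∉ p → ∣ ⁅ x ⁆ ∪ p ∣ ≡ suc ∣ p ∣
x∉p⇒∣⁅x⁆∪p∣≡1+∣p∣ {x = zero}  {true  ∷ p} x∉p = contradiction here x∉p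
x∉p⇒∣⁅x⁆∪p∣≡1+∣p∣ {x = zero}  {false ∷ p} x∉p = cong (suc ∘ ∣_∣) (∪-identityˡ p)
x∉p⇒∣⁅x⁆∪p∣≡1+∣p∣ {x = suc x} {true  ∷ p} x∉p = cong suc (x∉p⇒∣⁅x⁆∪p∣≡1+∣p∣ (x∉p ∘ there))
x∉p⇒∣⁅x⁆∪p∣≡1+∣p∣ {x = suc x} {false ∷ p} x∉p = x∉p⇒∣⁅x⁆∪p∣≡1+∣p∣ (x∉p ∘ there)

module _ {n : ℕ} (T : Tournament n) where

  adj-irrefl : ∀ {x y} → x ≡ y → adj T x y ≢ true
  adj-irrefl {x} refl x→x = contradiction (trans (sym x→x) (irrefl T x)) λ ()

  adj-asym : ∀ {u w} → adj T u w ≡ true → adj T w u ≡ false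
  adj-asym {u} {w} uw with u ≟ᶠ w
  ... | yes u≡w = contradiction uw (adj-irrefl u≡w)
  ... | no u≢w with tourn T u w u≢w
  ...   | inj₁ (_ , wu)  = wu
  ...   | inj₂ (¬uw , _) = contradiction (trans (sym uw) ¬uw) λ ()

  adj-flip : ∀ {u w} → u ≢ w → adj T u w ≡ false → adj T w u ≡ true
  adj-flip {u} {w} u≢w ¬uw with tourn T u w u≢w
  ... | inj₁ (uw , _) = contradiction (trans (sym uw) ¬uw) λ ()
  ... | inj₂ (_ , wu) = wu

  𝟙-adj-pair≤1 : ∀ u w → 𝟙 (adj T u w) + 𝟙 (adj T w u) ≤ 1
  𝟙-adj-pair≤1 u w with adj T u w in uw
  ... | true  rewrite adj-asym uw = ≤-refl
  ... | false = 𝟙≤1 (adj T w u)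

  x∈inNbrs⇔ : ∀ {x u} → x ∈ inNbrs T u ⇔ adj T x u ≡ true
  x∈inNbrs⇔ = x∈tabulate⇔

  ∉inNbrs⇒outNbr : ∀ {x u} → x ≢ u → x ∉ inNbrs T u → adj T u x ≡ true
  ∉inNbrs⇒outNbr x≢u x∉ = adj-flip x≢u (¬-not (x∉ ∘ from x∈inNbrs⇔))

  indegWithin : Subset n → Fin n → ℕ
  indegWithin E u = ∣ E ∩ inNbrs T u ∣

  indegWithin≡∑ : ∀ E u → indegWithin E u ≡ ∑[ w < n ] (𝟙 (lookup E w) * 𝟙 (adj T w u))
  indegWithin≡∑ E u = trans (∣p∣≡∑𝟙 (E ∩ inNbrs T u)) (sum-cong-≗ λ w → begin
    𝟙 (lookup (E ∩ inNbrs T u) w)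
      ≡⟨ cong 𝟙 (lookup-zipWith _∧_ w E (inNbrs T u)) ⟩
    𝟙 (lookup E w ∧ lookup (inNbrs T u) w)
      ≡⟨ cong (λ b → 𝟙 (lookup E w ∧ b)) (lookup∘tabulate _ w) ⟩
    𝟙 (lookup E w ∧ adj T w u)
      ≡⟨ 𝟙-∧ (lookup E w) (adj T w u) ⟩
    𝟙 (lookup E w) * 𝟙 (adj T w u)
      ∎)
    where open ≡-Reasoning

  arcsWithin : Subset n → ℕ
  arcsWithin E = ∑[ u < n ] (𝟙 (lookup E u) * indegWithin E u)

  2*arcsWithin≤∣E∣*∣E∣ : ∀ E → 2 * arcsWithin E ≤ ∣ E ∣ * ∣ E ∣
  2*arcsWithin≤∣E∣*∣E∣ E = begin
    2 * S
      ≡⟨ cong (S +_) (+-identityʳ S) ⟩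
    S + S
      ≡⟨ cong₂ _+_ S≡∑∑ (trans S≡∑∑ (∑-comm h)) ⟩
    ∑[ u < n ] ∑[ w < n ] h u w + ∑[ u < n ] ∑[ w < n ] h w u
      ≡⟨ ∑-distrib-+ (λ u → ∑[ w < n ] h u w) (λ u → ∑[ w < n ] h w u) ⟨
    ∑[ u < n ] (∑[ w < n ] h u w + ∑[ w < n ] h w u)
      ≡⟨ sum-cong-≗ (λ u → sym (∑-distrib-+ (h u) (λ w → h w u))) ⟩
    ∑[ u < n ] ∑[ w < n ] (h u w + h w u)
      ≤⟨ ∑-mono-≤ (λ u → ∑-mono-≤ (h-pair≤ u)) ⟩
    ∑[ u < n ] ∑[ w < n ] (e u * e w)
      ≡⟨ sum-cong-≗ (λ u → sym (*-distribˡ-sum (e u) e)) ⟩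
    ∑[ u < n ] (e u * ∑[ w < n ] e w)
      ≡⟨ *-distribʳ-sum (∑[ w < n ] e w) e ⟨
    (∑[ u < n ] e u) * (∑[ w < n ] e w)
      ≡⟨ cong₂ _*_ (∣p∣≡∑𝟙 E) (∣p∣≡∑𝟙 E) ⟨
    ∣ E ∣ * ∣ E ∣
      ∎
    where
    open ≤-Reasoning
    S = arcsWithin E
    e : Fin n → ℕ
    e u = 𝟙 (lookup E u)
    h : Fin n → Fin n → ℕ
    h u w = e u * (e w * 𝟙 (adj T w u))
    S≡∑∑ : S ≡ ∑[ u < n ] ∑[ w < n ] h u w
    S≡∑∑ = sum-cong-≗ λ u →
      trans (cong (e u *_) (indegWithin≡∑ E u)) (*-distribˡ-sum (e u) (λ w → e w * 𝟙 (adj T w u)))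
    factor : ∀ x y p q → x * (y * p) + y * (x * q) ≡ x * y * (p + q)
    factor = solve-∀
    h-pair≤ : ∀ u w → h u w + h w u ≤ e u * e w
    h-pair≤ u w = begin
      h u w + h w u                                      ≡⟨ factor (e u) (e w) _ _ ⟩
      e u * e w * (𝟙 (adj T w u) + 𝟙 (adj T u w))        ≤⟨ *-monoʳ-≤ (e u * e w) (𝟙-adj-pair≤1 w u) ⟩
      e u * e w * 1                                      ≡⟨ *-identityʳ _ ⟩
      e u * e w                                          ∎

  ∣E∣*[1+∣E∣]≤2*arcsWithin : ∀ E → (∀ u → u ∈ E → ∣ E ∣ < 2 * indegWithin E u) →
                             ∣ E ∣ * suc ∣ E ∣ ≤ 2 * arcsWithin E
  ∣E∣*[1+∣E∣]≤2*arcsWithin E large = begin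
    ∣ E ∣ * suc ∣ E ∣
      ≡⟨ cong (_* suc ∣ E ∣) (∣p∣≡∑𝟙 E) ⟩
    (∑[ u < n ] 𝟙 (lookup E u)) * suc ∣ E ∣
      ≡⟨ *-distribʳ-sum (suc ∣ E ∣) (𝟙 ∘ lookup E) ⟩
    ∑[ u < n ] (𝟙 (lookup E u) * suc ∣ E ∣)
      ≤⟨ ∑-mono-≤ pointwise ⟩
    ∑[ u < n ] (2 * (𝟙 (lookup E u) * indegWithin E u))
      ≡⟨ *-distribˡ-sum 2 (λ u → 𝟙 (lookup E u) * indegWithin E u) ⟨
    2 * arcsWithin E
      ∎
    where
    open ≤-Reasoning
    pointwise : ∀ u → 𝟙 (lookup E u) * suc ∣ E ∣ ≤ 2 * (𝟙 (lookup E u) * indegWithin E u)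
    pointwise u with lookup E u in E[u]
    ... | false = z≤n
    ... | true  rewrite *-identityˡ (suc ∣ E ∣) | *-identityˡ (indegWithin E u) =
      large u (lookup⇒[]= u E E[u])

  ∃-2*indegWithin≤∣E∣ : ∀ E → 0 < ∣ E ∣ → ∃ λ u → u ∈ E × 2 * indegWithin E u ≤ ∣ E ∣
  ∃-2*indegWithin≤∣E∣ E 0<∣E∣ with any? (λ u → (u ∈? E) ×-dec (2 * indegWithin E u ≤? ∣ E ∣))
  ... | yes found = found
  ... | no  none  = contradiction ∣E∣≤0 (<⇒≱ 0<∣E∣)
    where
    large : ∀ u → u ∈ E → ∣ E ∣ < 2 * indegWithin E u
    large u u∈E = ≰⇒> (λ small → none (u , u∈E , small))
    ∣E∣+∣E∣*∣E∣≤∣E∣*∣E∣ : ∣ E ∣ + ∣ E ∣ * ∣ E ∣ ≤ ∣ E ∣ * ∣ E ∣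
    ∣E∣+∣E∣*∣E∣≤∣E∣*∣E∣ = begin
      ∣ E ∣ + ∣ E ∣ * ∣ E ∣   ≡⟨ *-suc ∣ E ∣ ∣ E ∣ ⟨
      ∣ E ∣ * suc ∣ E ∣       ≤⟨ ∣E∣*[1+∣E∣]≤2*arcsWithin E large ⟩
      2 * arcsWithin E        ≤⟨ 2*arcsWithin≤∣E∣*∣E∣ E ⟩
      ∣ E ∣ * ∣ E ∣           ∎
      where open ≤-Reasoning
    ∣E∣≤0 : ∣ E ∣ ≤ 0
    ∣E∣≤0 = +-cancelʳ-≤ (∣ E ∣ * ∣ E ∣) ∣ E ∣ 0 ∣E∣+∣E∣*∣E∣≤∣E∣*∣E∣

  TransitiveListing : ∀ {m} → (Fin m → Fin n) → Set
  TransitiveListing f = ∀ i j → adj T (f i) (f j) ≡ true ⇔ i Fin.< j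

  TransitiveListing⇒injective : ∀ {m} {f : Fin m → Fin n} →
                                TransitiveListing f → Injective _≡_ _≡_ f
  TransitiveListing⇒injective {f = f} ordered {i} {j} fi≡fj with <ᶠ-cmp i j
  ... | tri< i<j _ _ = ⊥-elim (adj-irrefl fi≡fj (from (ordered i j) i<j))
  ... | tri≈ _ i≡j _ = i≡j
  ... | tri> _ _ j<i = ⊥-elim (adj-irrefl (sym fi≡fj) (from (ordered j i) j<i))

  TransitiveListing-∷ : ∀ {m u} {f : Fin m → Fin n} → (∀ i → adj T u (f i) ≡ true) →
                        TransitiveListing f → TransitiveListing (u Vector.∷ f)
  TransitiveListing-∷ beats ordered zero    zero    = mk⇔ (λ u→u → contradiction u→u (adj-irrefl refl)) λ ()
  TransitiveListing-∷ beats ordered zero    (suc j) = mk⇔ (λ _ → z<s) (λ _ → beats j)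
  TransitiveListing-∷ beats ordered (suc i) zero    =
    mk⇔ (λ fi→u → contradiction (trans (sym fi→u) (adj-asym (beats i))) λ ()) λ ()
  TransitiveListing-∷ beats ordered (suc i) (suc j) =
    mk⇔ (s<s ∘ to (ordered i j)) (from (ordered i j) ∘ s<s⁻¹)

0<⌊log₂n⌋⇒0<n : ∀ {n} → 0 < ⌊log₂ n ⌋ → 0 < n
0<⌊log₂n⌋⇒0<n {suc n} _ = z<s

module Construction {n : ℕ} (T : Tournament n) (v : Fin n) where

  record Stage (k : ℕ) : Set where
    field
      listing    : Fin (suc k) → Fin n
      A E        : Subset n
      transitive : TransitiveListing T listing
      head       : listing (fromℕ k) ≡ v
      A-listed   : ∀ x → x ∈ A ⇔ ∃ λ i → listing i ≡ x
      ∣A∣≡1+k     : ∣ A ∣ ≡ suc k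
      E-beats    : ∀ x i → x ∈ E → adj T x (listing i) ≡ true
      dominates  : OutDominates T A (∁ (A ∪ E))
      ∣E∣-bound   : ∣ E ∣ * 2 ^ k ≤ indeg T v

    disjoint : Disjoint A E
    disjoint x x∈A x∈E with to (A-listed x) x∈A
    ... | i , refl = adj-irrefl T refl (E-beats (listing i) i x∈E)

  stage₀ : Stage 0
  stage₀ = record
    { listing    = λ _ → v
    ; A          = ⁅ v ⁆
    ; E          = inNbrs T v
    ; transitive = λ { zero zero → mk⇔ (λ v→v → contradiction v→v (adj-irrefl T refl)) λ () }
    ; head       = refl
    ; A-listed   = λ x → mk⇔ (λ x∈ → zero , sym (x∈⁅y⁆⇒x≡y v x∈)) λ { (zero , refl) → x∈⁅x⁆ v }
    ; ∣A∣≡1+k     = ∣⁅x⁆∣≡1 v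
    ; E-beats    = λ { x zero x∈E → to (x∈inNbrs⇔ T) x∈E }
    ; dominates  = λ z z∉ → let (z∉A , z∉E) = to x∈∁[p∪q]⇔ z∉ in
                     v , x∈⁅x⁆ v , ∉inNbrs⇒outNbr T (z∉A ∘ λ { refl → x∈⁅x⁆ v }) z∉E
    ; ∣E∣-bound   = ≤-reflexive (*-identityʳ (indeg T v))
    }

  advance : ∀ {k} (s : Stage k) → 0 < ∣ Stage.E s ∣ → Stage (suc k)
  advance {k} s 0<∣E∣ = record
    { listing    = u Vector.∷ listing
    ; A          = ⁅ u ⁆ ∪ A
    ; E          = E ∩ inNbrs T u
    ; transitive = TransitiveListing-∷ T (λ i → E-beats u i u∈E) transitive
    ; head       = head
    ; A-listed   = A′-listed
    ; ∣A∣≡1+k     = trans (x∉p⇒∣⁅x⁆∪p∣≡1+∣p∣ (λ u∈A → disjoint u u∈A u∈E)) (cong suc ∣A∣≡1+k)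
    ; E-beats    = E′-beats
    ; dominates  = dominates′
    ; ∣E∣-bound   = ∣E′∣-bound
    }
    where
    open Stage s
    chosen = ∃-2*indegWithin≤∣E∣ T E 0<∣E∣
    u = proj₁ chosen
    u∈E = proj₁ (proj₂ chosen)

    A′-listed : ∀ x → x ∈ ⁅ u ⁆ ∪ A ⇔ ∃ λ i → (u Vector.∷ listing) i ≡ x
    A′-listed x = mk⇔ listed member
      where
      listed : x ∈ ⁅ u ⁆ ∪ A → ∃ λ i → (u Vector.∷ listing) i ≡ x
      listed x∈ with x∈p∪q⁻ ⁅ u ⁆ A x∈
      ... | inj₁ x∈⁅u⁆ = zero , sym (x∈⁅y⁆⇒x≡y u x∈⁅u⁆)
      ... | inj₂ x∈A   = let (i , listing-i≡x) = to (A-listed x) x∈A in suc i , listing-i≡x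
      member : ∃ (λ i → (u Vector.∷ listing) i ≡ x) → x ∈ ⁅ u ⁆ ∪ A
      member (zero  , refl) = x∈p∪q⁺ (inj₁ (x∈⁅x⁆ u))
      member (suc i , refl) = x∈p∪q⁺ (inj₂ (from (A-listed x) (i , refl)))

    E′-beats : ∀ x i → x ∈ E ∩ inNbrs T u → adj T x ((u Vector.∷ listing) i) ≡ true
    E′-beats x zero    x∈ = to (x∈inNbrs⇔ T) (proj₂ (x∈p∩q⁻ E (inNbrs T u) x∈))
    E′-beats x (suc i) x∈ = E-beats x i (proj₁ (x∈p∩q⁻ E (inNbrs T u) x∈))

    dominates′ : OutDominates T (⁅ u ⁆ ∪ A) (∁ ((⁅ u ⁆ ∪ A) ∪ (E ∩ inNbrs T u)))
    dominates′ z z∉ with to x∈∁[p∪q]⇔ z∉ | z ∈? E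
    ... | z∉A′ , z∉E′ | yes z∈E =
      u , x∈p∪q⁺ (inj₁ (x∈⁅x⁆ u)) ,
      ∉inNbrs⇒outNbr T (λ { refl → z∉A′ (x∈p∪q⁺ (inj₁ (x∈⁅x⁆ u))) }) (z∉E′ ∘ x∈p∩q⁺ ∘ (z∈E ,_))
    ... | z∉A′ , _    | no z∉E =
      let (a , a∈A , a→z) = dominates z (from x∈∁[p∪q]⇔ (z∉A′ ∘ x∈p∪q⁺ ∘ inj₂ , z∉E))
      in a , x∈p∪q⁺ (inj₂ a∈A) , a→z

    ∣E′∣-bound : indegWithin T E u * 2 ^ suc k ≤ indeg T v
    ∣E′∣-bound = begin
      indegWithin T E u * (2 * 2 ^ k)   ≡⟨ *-assoc-comm (indegWithin T E u) 2 (2 ^ k) ⟩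
      2 * indegWithin T E u * 2 ^ k     ≤⟨ *-monoˡ-≤ (2 ^ k) (proj₂ (proj₂ chosen)) ⟩
      ∣ E ∣ * 2 ^ k                     ≤⟨ ∣E∣-bound ⟩
      indeg T v                         ∎
      where
      open ≤-Reasoning
      *-assoc-comm : ∀ x y z → x * (y * z) ≡ y * x * z
      *-assoc-comm = solve-∀

  -- When the growth stops early E is empty, so the final bound holds for the
  -- target exponent k + m regardless of the size reached.
  record Grown (k m : ℕ) : Set where
    field
      {size}   : ℕ
      stage    : Stage size
      k≤size   : k ≤ size
      size≤k+m : size ≤ k + m
      ∣E∣-final : ∣ Stage.E stage ∣ * 2 ^ (k + m) ≤ indeg T v

  grow : ∀ m {k} → Stage k → Grown k m
  grow zero {k} s = record
    { stage    = s
    ; k≤size   = ≤-refl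
    ; size≤k+m = m≤m+n k 0
    ; ∣E∣-final = subst (λ t → ∣ Stage.E s ∣ * 2 ^ t ≤ indeg T v) (sym (+-identityʳ k))
                        (Stage.∣E∣-bound s)
    }
  grow (suc m) {k} s with ∣ Stage.E s ∣ ≟ 0
  ... | yes ∣E∣≡0 = record
    { stage    = s
    ; k≤size   = ≤-refl
    ; size≤k+m = m≤m+n k (suc m)
    ; ∣E∣-final = subst (λ e → e * 2 ^ (k + suc m) ≤ indeg T v) (sym ∣E∣≡0) z≤n
    }
  ... | no ∣E∣≢0 = record
    { stage    = stage
    ; k≤size   = ≤-trans (n≤1+n k) k≤size
    ; size≤k+m = subst (size ≤_) (sym (+-suc k m)) size≤k+m
    ; ∣E∣-final = subst (λ t → ∣ Stage.E stage ∣ * 2 ^ t ≤ indeg T v) (sym (+-suc k m)) ∣E∣-final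
    }
    where open Grown (grow m (advance s (n≢0⇒n>0 ∣E∣≢0)))

lemma8p3 : (n : ℕ) (T : Tournament n) (v : Fin n) (c : ℕ) →
    2 ≤ c → c + 1 ≤ ⌊log₂ indeg T v ⌋ →
    Σ (Subset n) λ A → Σ (Subset n) λ E →
      Disjoint A E
      × (2 ≤ ∣ A ∣ × ∣ A ∣ ≤ c × TransitiveWithHead T A v)
      × OutDominates T A (∁ (A ∪ E))
      × (∣ E ∣ * 2 ^ (c ∸ 1) ≤ indeg T v)
lemma8p3 n T v (suc (suc c)) (s≤s (s≤s z≤n)) c+1≤log =
  A , E , disjoint ,
  ( subst (2 ≤_) (sym ∣A∣≡1+k) (s≤s k≤size)
  , subst (_≤ suc (suc c)) (sym ∣A∣≡1+k) (s≤s size≤k+m)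
  , (size , listing , TransitiveListing⇒injective T transitive , A-listed , transitive , head)
  ) ,
  dominates , ∣E∣-final
  where
  open Construction T v
  0<d⁻v : 0 < indeg T v
  0<d⁻v = 0<⌊log₂n⌋⇒0<n (≤-trans z<s c+1≤log)
  open Grown (grow c (advance stage₀ 0<d⁻v))
  open Stage stage
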